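{- Let $\psi$ be a translation on a graph $G=(V,E)$, and let $\psi^{ -1}$ be the map defined by $\psi^{ -1}(\bot)=\bot$, $\psi^{ -1}(w)=v$ if $w=\psi(v)$ for some $v\in V$, and $\psi^{ -1}(w)=\bot$ for $w\in V$ not in $\{\psi(v): v\in V\}$ (so the associated digraph of $\psi^{ -1}$ is that of $\psi$ with all diedges reversed). Then $\mathrm{loss}(\psi)=\mathrm{loss}(\psi^{ -1})$.
   Context: A graph $G=(V,E)$ is finite, simple and undirected. Let $\bot$ be a symbol not in $V$. A transformation on $G$ is a map $\phi : V\cup\{\bot\} \to V \cup\{\bot\}$ with $\phi(\bot)=\bot$ that is injective on $V_{\not\bot} := \{v \in V : \phi(v) \neq \bot\}$; its loss is $\mathrm{loss}(\phi)=|\{v\in V : \phi(v)=\bot\}|$. It is edge-constrained (EC) if $\{v,\phi(v)\} \in E$ for all $v \in V_{\not\bot}$, and strongly neighborhood-preserving (SNP) if for all $v_1,v_2 \in V_{\not\bot}$: $\{v_1,v_2\}\in E \Leftrightarrow \{\phi(v_1),\phi(v_2)\} \in E$. A translation is an EC and SNP transformation. The associated digraph of a transformation $\phi$ has diedges $(v,\phi(v))$ for $v\in V_{\not\bot}$. -}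

module Defs where

open import Data.Nat using (ℕ)
open import Data.Fin using (Fin)
open import Data.Fin.Properties using (_≟_)
open import Data.Maybe using (Maybe; just; nothing; is-nothing)
open import Data.List using (List; length; filter)
open import Data.List.Base using (allFin)
open import Data.Bool using (T)
open import Data.Product using (Σ; _×_; _,_)
open import Relation.Binary.PropositionalEquality using (_≡_)
open import Relation.Nullary using (¬_; Dec; yes; no)
open import Relation.Unary using (Decidable)
open import Data.Fin.Properties using (any?)
open import Data.Empty using (⊥)

record Graph (n : ℕ) : Set₁ where
  field
    Adj   : Fin n → Fin n → Set
    adj?  : (u v : Fin n) → Dec (Adj u v)
    sym   : ∀ {u v} → Adj u v → Adj v u
    irrefl : ∀ {u} → ¬ Adj u u

-- A transformation: V ∪ {⊥} → V ∪ {⊥} with ⊥ ↦ ⊥; we represent it by its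
-- restriction to V, with ⊥ encoded as nothing.
Map : ℕ → Set
Map n = Fin n → Maybe (Fin n)

IsTransformation : ∀ {n} → Map n → Set
IsTransformation {n} φ = ∀ (u v w : Fin n) → φ u ≡ just w → φ v ≡ just w → u ≡ v

loss : ∀ {n} → Map n → ℕ
loss {n} φ = length (filter (λ v → Data.Bool.Properties.T? (is-nothing (φ v))) (allFin n))
  where import Data.Bool.Properties

EdgeConstrained : ∀ {n} → Graph n → Map n → Set
EdgeConstrained {n} G φ = ∀ (v w : Fin n) → φ v ≡ just w → Graph.Adj G v w

StronglyNeighborhoodPreserving : ∀ {n} → Graph n → Map n → Set
StronglyNeighborhoodPreserving {n} G φ =
  ∀ (v₁ v₂ w₁ w₂ : Fin n) → φ v₁ ≡ just w₁ → φ v₂ ≡ just w₂ →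
    (Graph.Adj G v₁ v₂ → Graph.Adj G w₁ w₂) × (Graph.Adj G w₁ w₂ → Graph.Adj G v₁ v₂)

IsTranslation : ∀ {n} → Graph n → Map n → Set
IsTranslation G φ = IsTransformation φ × EdgeConstrained G φ × StronglyNeighborhoodPreserving G φ

-- ψ⁻¹(w) = v if w = ψ(v) for some v ∈ V (v is unique when ψ is injective on
-- V_{≠⊥}), and ⊥ otherwise. Computed by searching V for such a v.
inverse : ∀ {n} → Map n → Map n
inverse {n} ψ w with any? (λ v → Data.Maybe.Properties.≡-dec _≟_ (ψ v) (just w))
  where import Data.Maybe.Properties
... | yes (v , _) = just v
... | no _ = nothing

-- The diedges v → ψ v form a 0/1 matrix E indexed by V × V. Every row of E has
-- exactly one 1 unless ψ is undefined there, and, ψ being injective, every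
-- column has exactly one 1 unless ψ⁻¹ is undefined there. Hence
-- loss ψ + |E| = |V| = loss ψ⁻¹ + |E|.
module Submission where

open import Defs
open import Data.Nat.Properties using (+-cancelʳ-≡; +-0-commutativeMonoid)
open import Algebra.Properties.CommutativeMonoid.Sum +-0-commutativeMonoid
  using (sum-syntax; sum-cong-≗; ∑-distrib-+; ∑-comm)
open import Data.Bool using (T)
open import Data.Bool.Properties using (T?)
open import Data.Fin using (Fin; zero; suc)
open import Data.Fin.Properties using (_≟_; any?; 0≢1+n; suc-injective)
open import Data.List using (length; filter; tabulate)
open import Data.Maybe using (just; nothing; is-nothing)
open import Data.Maybe.Properties using (≡-dec; just-injective)
open import Data.Nat using (ℕ; zero; suc; _+_)
open import Data.Product using (_×_; _,_; ∃-syntax)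
open import Data.Sum using (_⊎_; inj₁; inj₂)
open import Function using (id)
open import Relation.Binary.PropositionalEquality
  using (_≡_; _≢_; refl; sym; cong; module ≡-Reasoning)
open import Relation.Nullary using (¬_; Dec; yes; no; contradiction)
open import Relation.Unary using (Pred; Decidable)

indicator : ∀ {p} {P : Set p} → Dec P → ℕ
indicator (yes _) = 1
indicator (no _)  = 0

length-filter-tabulate : ∀ {a p n} {A : Set a} {P : Pred A p} (P? : Decidable P)
  (f : Fin n → A) → length (filter P? (tabulate f)) ≡ ∑[ i < n ] indicator (P? (f i))
length-filter-tabulate {n = zero}  P? f = refl
length-filter-tabulate {n = suc n} P? f with P? (f zero)
... | yes _ = cong suc (length-filter-tabulate P? (λ i → f (suc i)))
... | no  _ = length-filter-tabulate P? (λ i → f (suc i))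

∑-indicator-none : ∀ {p n} {P : Pred (Fin n) p} (P? : Decidable P) →
  (∀ i → ¬ P i) → ∑[ i < n ] indicator (P? i) ≡ 0
∑-indicator-none {n = zero}  P? none = refl
∑-indicator-none {n = suc n} P? none with P? zero
... | yes P0 = contradiction P0 (none zero)
... | no  _  = ∑-indicator-none (λ i → P? (suc i)) (λ i → none (suc i))

∑-indicator-unique : ∀ {p n} {P : Pred (Fin n) p} (P? : Decidable P) {u : Fin n} →
  P u → (∀ i → P i → i ≡ u) → ∑[ i < n ] indicator (P? i) ≡ 1
∑-indicator-unique P? {zero} Pu unique with P? zero
... | yes _   = cong suc (∑-indicator-none (λ i → P? (suc i))
                  (λ i Psi → 0≢1+n (sym (unique (suc i) Psi))))
... | no ¬P0 = contradiction Pu ¬P0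
∑-indicator-unique P? {suc u} Pu unique with P? zero
... | yes P0 = contradiction (unique zero P0) 0≢1+n
... | no  _  = ∑-indicator-unique (λ i → P? (suc i)) Pu
                 (λ i Psi → suc-injective (unique (suc i) Psi))

∑-complement-rows≡∑-complement-columns : ∀ {n c} (M : Fin n → Fin n → ℕ) (a b : Fin n → ℕ) →
  (∀ i → a i + ∑[ j < n ] M i j ≡ c) → (∀ j → b j + ∑[ i < n ] M i j ≡ c) →
  ∑[ i < n ] a i ≡ ∑[ j < n ] b j
∑-complement-rows≡∑-complement-columns {n} {c} M a b rows columns =
  +-cancelʳ-≡ _ _ _ (begin
    ∑[ i < n ] a i + ∑[ i < n ] ∑[ j < n ] M i j  ≡⟨ sym (∑-distrib-+ a _) ⟩
    ∑[ i < n ] (a i + ∑[ j < n ] M i j)           ≡⟨ sum-cong-≗ rows ⟩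
    ∑[ i < n ] c                                  ≡⟨ sym (sum-cong-≗ columns) ⟩
    ∑[ j < n ] (b j + ∑[ i < n ] M i j)           ≡⟨ ∑-distrib-+ b _ ⟩
    ∑[ j < n ] b j + ∑[ j < n ] ∑[ i < n ] M i j  ≡⟨ cong (∑[ j < n ] b j +_) (sym (∑-comm M)) ⟩
    ∑[ j < n ] b j + ∑[ i < n ] ∑[ j < n ] M i j  ∎)
  where open ≡-Reasoning

undefined? : ∀ {n} (φ : Map n) v → Dec (T (is-nothing (φ v)))
undefined? φ v = T? (is-nothing (φ v))

loss≡∑-undefined : ∀ {n} (φ : Map n) → loss φ ≡ ∑[ v < n ] indicator (undefined? φ v)
loss≡∑-undefined φ = length-filter-tabulate (undefined? φ) id

module _ {n : ℕ} (ψ : Map n) where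

  maps-to? : ∀ v w → Dec (ψ v ≡ just w)
  maps-to? v w = ≡-dec _≟_ (ψ v) (just w)

  undefined+out-degree≡1 : ∀ v → indicator (undefined? ψ v) + ∑[ w < n ] indicator (maps-to? v w) ≡ 1
  undefined+out-degree≡1 v with ψ v
  ... | nothing = cong suc (∑-indicator-none {n = n} (λ w → ≡-dec _≟_ nothing (just w)) (λ _ ()))
  ... | just u  = ∑-indicator-unique (λ w → ≡-dec _≟_ (just u) (just w)) refl
                    (λ w u≡w → sym (just-injective u≡w))

  inverse-cases : ∀ w → (∃[ v ] ψ v ≡ just w × inverse ψ w ≡ just v)
                      ⊎ ((∀ v → ψ v ≢ just w) × inverse ψ w ≡ nothing)
  inverse-cases w with any? (λ v → maps-to? v w)
  ... | yes (v , ψv≡w) = inj₁ (v , ψv≡w , refl)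
  ... | no  ∄v         = inj₂ ((λ v ψv≡w → ∄v (v , ψv≡w)) , refl)

  inverse-undefined+in-degree≡1 : IsTransformation ψ →
    ∀ w → indicator (undefined? (inverse ψ) w) + ∑[ v < n ] indicator (maps-to? v w) ≡ 1
  inverse-undefined+in-degree≡1 injective w with inverse-cases w
  ... | inj₁ (v , ψv≡w , ψ⁻¹w≡v) rewrite ψ⁻¹w≡v =
    ∑-indicator-unique (λ v′ → maps-to? v′ w) ψv≡w (λ v′ ψv′≡w → injective v′ v w ψv′≡w ψv≡w)
  ... | inj₂ (∄v , ψ⁻¹w≡⊥) rewrite ψ⁻¹w≡⊥ =
    cong suc (∑-indicator-none (λ v → maps-to? v w) ∄v)

proposition5 : ∀ {n : ℕ} (G : Graph n) (ψ : Map n) →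
    IsTranslation G ψ → loss ψ ≡ loss (inverse ψ)
proposition5 {n} G ψ (injective , _) = begin
  loss ψ                                              ≡⟨ loss≡∑-undefined ψ ⟩
  ∑[ v < n ] indicator (undefined? ψ v)               ≡⟨ ∑-complement-rows≡∑-complement-columns
                                                           (λ v w → indicator (maps-to? ψ v w)) _ _
                                                           (undefined+out-degree≡1 ψ)
                                                           (inverse-undefined+in-degree≡1 ψ injective) ⟩
  ∑[ w < n ] indicator (undefined? (inverse ψ) w)     ≡⟨ sym (loss≡∑-undefined (inverse ψ)) ⟩
  loss (inverse ψ)                                    ∎
  where open ≡-Reasoning
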